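{- Let $f:2^{\mathcal{N}}\to\mathbb{Z}_{\ge0}$ be a polymatroid with $f(\{e\})>0$ for every $e\in\mathcal{N}$, $r=f(\mathcal{N})$, and let $e_1,\dots,e_n$ be an ordering of $\mathcal{N}$ with $\mathcal{N}_t=\{e_1,\dots,e_t\}$. For $t\in[n]$, let $\mathcal{N}_t=S_0\supseteq S_1\supseteq\dots\supseteq S_w=\emptyset$ be a strength decomposition of $\mathcal{N}_t$ with respect to $f_{|\mathcal{N}_t}$, let $i$ be the index with $e_t\in S_{i-1}\setminus S_i$, and let $\eta_t=\frac{|\mathcal{N}_t\setminus S_i|}{f(\mathcal{N}_t)-f(S_i)}$. Let $q_t=\min\{|Q|: e_t\in Q\subseteq\mathcal{N}_t,\ Q\text{ a quotient of }f_{|\mathcal{N}_t}\}$. Then $\frac{q_t}{r}\le\eta_t\le q_t$.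
   Context: A polymatroid is an integer-valued, monotone, submodular set function with value $0$ on the empty set; $f_{|S}$ is its restriction to ground set $S$. A set $Q\subseteq\mathcal{V}$ is a quotient of a polymatroid $g$ on $\mathcal{V}$ if $g((\mathcal{V}\setminus Q)\cup\{e\})>g(\mathcal{V}\setminus Q)$ for all $e\in Q$. For a polymatroid $g$ on $\mathcal{M}$ and $T\subseteq S\subseteq\mathcal{M}$, $\varphi(T|S)=\frac{|S|-|T|}{g(S)-g(T)}$ with $x/0=+\infty$. A strength decomposition of $\mathcal{M}$ with respect to $g$ is a sequence $S_0\supseteq\dots\supseteq S_w$ with $S_0=\mathcal{M}$; $S_w=\emptyset$ and $S_i\ne\emptyset$ for $i<w$; each $S_i$ ($i\in[w]$) minimizes $\varphi(S|S_{i-1})$ over $S\subseteq S_{i-1}$; and $\varphi(S_i|S_{i-1})$ is nondecreasing in $i$. -}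

module Defs where

open import Data.Nat using (ℕ; zero; suc; _+_; _*_; _∸_; _≤_; _<_; _≤ᵇ_)
open import Data.Fin using (Fin; toℕ)
open import Data.Fin.Subset using (Subset; _⊆_; _∪_; _∩_; _─_; ⁅_⁆; ⊥; ∣_∣; _∈_; _∉_)
open import Data.Vec using (tabulate)
open import Data.Bool using (Bool; true; false)
open import Data.Product using (_×_; ∃)
open import Data.Unit using (⊤)
open import Data.Empty renaming (⊥ to Empty)
open import Relation.Binary.PropositionalEquality using (_≡_)
open import Relation.Nullary using (¬_)

SetFun : ℕ → Set
SetFun n = Subset n → ℕ

record IsPolymatroid {n : ℕ} (f : SetFun n) : Set where
  field
    empty0     : f ⊥ ≡ 0
    monotone   : ∀ {S T} → S ⊆ T → f S ≤ f T
    submodular : ∀ S T → f (S ∪ T) + f (S ∩ T) ≤ f S + f T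

-- Extended nonnegative ratios a / b, with x / 0 = +∞.
-- ratio a b ≤ᵉ ratio c d  compares a/b ≤ c/d in [0, +∞].
record Ratio : Set where
  constructor _/_
  field
    num : ℕ
    den : ℕ

infix 4 _≤ᵉ_
_≤ᵉ_ : Ratio → Ratio → Set
(a / b) ≤ᵉ (c / zero) = ⊤
(a / zero) ≤ᵉ (c / suc d) = Empty
(a / suc b) ≤ᵉ (c / suc d) = a * suc d ≤ c * suc b

φ : {n : ℕ} → SetFun n → Subset n → Subset n → Ratio
φ g T S = (∣ S ∣ ∸ ∣ T ∣) / (g S ∸ g T)

-- Strength decomposition M = S 0 ⊇ S 1 ⊇ ... ⊇ S w = ∅ of M w.r.t. g
-- (indices beyond w are irrelevant).  S i ⊆ S (i-1) is part of
-- "S i minimizes φ(S | S (i-1)) over S ⊆ S (i-1)".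
record IsStrengthDecomposition {n : ℕ} (g : SetFun n) (M : Subset n)
                               (w : ℕ) (S : ℕ → Subset n) : Set where
  field
    start     : S 0 ≡ M
    end       : S w ≡ ⊥
    nonempty  : ∀ i → i < w → ¬ (S i ≡ ⊥)
    sub       : ∀ i → suc i ≤ w → S (suc i) ⊆ S i
    minimizes : ∀ i → suc i ≤ w → ∀ T → T ⊆ S i →
                φ g (S (suc i)) (S i) ≤ᵉ φ g T (S i)
    nondecr   : ∀ i → suc (suc i) ≤ w →
                φ g (S (suc i)) (S i) ≤ᵉ φ g (S (suc (suc i))) (S (suc i))

IsQuotient : {n : ℕ} → SetFun n → Subset n → Subset n → Set
IsQuotient g V Q = Q ⊆ V × (∀ e → e ∈ Q → g (V ─ Q) < g ((V ─ Q) ∪ ⁅ e ⁆))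

-- prefix t = N_t = {e_1, ..., e_t} where e_{j+1} is the element j : Fin n
-- (so the Fin index t corresponds to the paper's t+1)
prefix : {n : ℕ} → Fin n → Subset n
prefix t = tabulate (λ j → toℕ j ≤ᵇ toℕ t)

IsMinQuotientSize : {n : ℕ} → SetFun n → Subset n → Fin n → ℕ → Set
IsMinQuotientSize g V e q =
  (∃ λ Q → IsQuotient g V Q × e ∈ Q × ∣ Q ∣ ≡ q)
  × (∀ Q → IsQuotient g V Q → e ∈ Q → q ≤ ∣ Q ∣)

-- Upper bound.  Let Q ∋ t be a minimum quotient.  For every level k < i, t ∈ S k,
-- and S k ∖ Q is a competitor in the minimisation defining S (k+1): by diminishing
-- returns t still raises f on top of it, so its φ-value is at most |Q| = q.  Hence
-- |S k| − |S (k+1)| ≤ q (f (S k) − f (S (k+1))), and these steps telescope to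
-- |N_t ∖ S i| ≤ q (f N_t − f (S i)).
-- Lower bound.  Every element outside S k raises f (S k): otherwise adding it to
-- S (k+1) would keep the denominator of φ and shrink the numerator.  So N_t ∖ S i is
-- a quotient containing t, whence q ≤ |N_t ∖ S i|, while f N_t − f (S i) ≤ f 𝒩 = r.
module Submission where

open import Defs
open import Data.Nat using (ℕ; zero; suc; _+_; _*_; _∸_; _≤_; _<_; _≤′_; ≤′-refl; ≤′-step; z≤n; s≤s)
open import Data.Nat.Properties
open import Data.Fin using (Fin)
open import Data.Fin.Subset using (Subset; inside; outside; _∈_; _∉_; _⊆_; _∪_; _∩_; _─_; ⁅_⁆; ⊤; ⊥; ∣_∣; Nonempty)
open import Data.Fin.Subset.Properties
open import Data.Vec using (_∷_; []; here; there)
open import Data.Product using (_×_; _,_; proj₁; proj₂)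
open import Data.Sum using (inj₁; inj₂)
open import Relation.Nullary using (yes; no; contradiction)
open import Relation.Binary.PropositionalEquality using (_≡_; refl; sym; trans; cong; subst; subst₂; module ≡-Reasoning)

x∈p─q⇒x∉q : ∀ {n} {x : Fin n} (p q : Subset n) → x ∈ p ─ q → x ∉ q
x∈p─q⇒x∉q (inside ∷ p) (outside ∷ q) here ()
x∈p─q⇒x∉q (_ ∷ p) (_ ∷ q) (there x∈p─q) (there x∈q) = x∈p─q⇒x∉q p q x∈p─q x∈q

p⊆q∧x∈q⇒p∪⁅x⁆⊆q : ∀ {n} {p q : Subset n} {x} → p ⊆ q → x ∈ q → p ∪ ⁅ x ⁆ ⊆ q
p⊆q∧x∈q⇒p∪⁅x⁆⊆q {p = p} {x = x} p⊆q x∈q y∈p∪⁅x⁆ with x∈p∪q⁻ p ⁅ x ⁆ y∈p∪⁅x⁆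
... | inj₁ y∈p = p⊆q y∈p
... | inj₂ y∈⁅x⁆ = subst (_∈ _) (sym (x∈⁅y⁆⇒x≡y x y∈⁅x⁆)) x∈q

p─[p─q]≡q : ∀ {n} {p q : Subset n} → q ⊆ p → p ─ (p ─ q) ≡ q
p─[p─q]≡q {p = []} {[]} _ = refl
p─[p─q]≡q {p = inside ∷ p} {inside ∷ q} q⊆p = cong (inside ∷_) (p─[p─q]≡q (drop-∷-⊆ q⊆p))
p─[p─q]≡q {p = inside ∷ p} {outside ∷ q} q⊆p = cong (outside ∷_) (p─[p─q]≡q (drop-∷-⊆ q⊆p))
p─[p─q]≡q {p = outside ∷ p} {inside ∷ q} q⊆p = contradiction (q⊆p here) λ ()
p─[p─q]≡q {p = outside ∷ p} {outside ∷ q} q⊆p = cong (outside ∷_) (p─[p─q]≡q (drop-∷-⊆ q⊆p))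

∣p∣≤∣p─q∣+∣q∣ : ∀ {n} (p q : Subset n) → ∣ p ∣ ≤ ∣ p ─ q ∣ + ∣ q ∣
∣p∣≤∣p─q∣+∣q∣ [] [] = z≤n
∣p∣≤∣p─q∣+∣q∣ (inside ∷ p) (inside ∷ q) =
  ≤-trans (s≤s (∣p∣≤∣p─q∣+∣q∣ p q)) (≤-reflexive (sym (+-suc ∣ p ─ q ∣ ∣ q ∣)))
∣p∣≤∣p─q∣+∣q∣ (inside ∷ p) (outside ∷ q) = s≤s (∣p∣≤∣p─q∣+∣q∣ p q)
∣p∣≤∣p─q∣+∣q∣ (outside ∷ p) (inside ∷ q) =
  ≤-trans (∣p∣≤∣p─q∣+∣q∣ p q) (+-monoʳ-≤ ∣ p ─ q ∣ (n≤1+n ∣ q ∣))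
∣p∣≤∣p─q∣+∣q∣ (outside ∷ p) (outside ∷ q) = ∣p∣≤∣p─q∣+∣q∣ p q

∣p─q∣+∣q∣≡∣p∣ : ∀ {n} {p q : Subset n} → q ⊆ p → ∣ p ─ q ∣ + ∣ q ∣ ≡ ∣ p ∣
∣p─q∣+∣q∣≡∣p∣ {p = []} {[]} _ = refl
∣p─q∣+∣q∣≡∣p∣ {p = inside ∷ p} {inside ∷ q} q⊆p =
  trans (+-suc ∣ p ─ q ∣ ∣ q ∣) (cong suc (∣p─q∣+∣q∣≡∣p∣ (drop-∷-⊆ q⊆p)))
∣p─q∣+∣q∣≡∣p∣ {p = inside ∷ p} {outside ∷ q} q⊆p = cong suc (∣p─q∣+∣q∣≡∣p∣ (drop-∷-⊆ q⊆p))
∣p─q∣+∣q∣≡∣p∣ {p = outside ∷ p} {inside ∷ q} q⊆p = contradiction (q⊆p here) λ ()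
∣p─q∣+∣q∣≡∣p∣ {p = outside ∷ p} {outside ∷ q} q⊆p = ∣p─q∣+∣q∣≡∣p∣ (drop-∷-⊆ q⊆p)

a/b≤ᵉc/d⇒0<b : ∀ {a b c d} → 0 < d → (a / b) ≤ᵉ (c / d) → 0 < b
a/b≤ᵉc/d⇒0<b {b = suc b} {d = suc d} _ _ = s≤s z≤n

a/b≤ᵉc/d⇒a≤c*b : ∀ {a b c d} → 0 < d → (a / b) ≤ᵉ (c / d) → a ≤ c * b
a/b≤ᵉc/d⇒a≤c*b {a} {suc b} {c} {suc d} _ ad≤cb = ≤-trans (m≤m*n a (suc d)) ad≤cb

a/b≤ᵉc/b⇒a≤c : ∀ {a b c} → 0 < b → (a / b) ≤ᵉ (c / b) → a ≤ c
a/b≤ᵉc/b⇒a≤c {a} {suc b} {c} _ ab≤cb = *-cancelʳ-≤ a c (suc b) ab≤cb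

a*d≤c*b⇒a/b≤ᵉc/d : ∀ {a b c d} → 0 < b → 0 < d → a * d ≤ c * b → (a / b) ≤ᵉ (c / d)
a*d≤c*b⇒a/b≤ᵉc/d {b = suc b} {d = suc d} _ _ ad≤cb = ad≤cb

∸-telescope : ∀ {x y z} → z ≤ y → y ≤ x → (y ∸ z) + (x ∸ y) ≡ x ∸ z
∸-telescope {x} {y} {z} z≤y y≤x = begin
  (y ∸ z) + (x ∸ y) ≡⟨ +-comm (y ∸ z) (x ∸ y) ⟩
  (x ∸ y) + (y ∸ z) ≡⟨ +-∸-assoc (x ∸ y) z≤y ⟨
  (x ∸ y) + y ∸ z   ≡⟨ cong (_∸ z) (m∸n+n≡m y≤x) ⟩
  x ∸ z             ∎
  where open ≡-Reasoning

telescoping-bound : (c g : ℕ → ℕ) (q m : ℕ)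
  → (∀ k → k < m → g (suc k) ≤ g k)
  → (∀ k → k < m → c k ≤ c (suc k) + q * (g k ∸ g (suc k)))
  → g m ≤ g 0 × c 0 ≤ c m + q * (g 0 ∸ g m)
telescoping-bound c g q zero _ _ = ≤-refl , m≤m+n (c 0) _
telescoping-bound c g q (suc m) descends steps = ≤-trans g-step g-total , (begin
    c 0                                               ≤⟨ c-total ⟩
    c m + q * (g 0 ∸ g m)                             ≤⟨ +-monoˡ-≤ _ (steps m ≤-refl) ⟩
    c (suc m) + q * (g m ∸ g (suc m)) + q * (g 0 ∸ g m)
      ≡⟨ +-assoc (c (suc m)) _ _ ⟩
    c (suc m) + (q * (g m ∸ g (suc m)) + q * (g 0 ∸ g m))
      ≡⟨ cong (c (suc m) +_) (*-distribˡ-+ q _ _) ⟨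
    c (suc m) + q * ((g m ∸ g (suc m)) + (g 0 ∸ g m))
      ≡⟨ cong (λ d → c (suc m) + q * d) (∸-telescope g-step g-total) ⟩
    c (suc m) + q * (g 0 ∸ g (suc m))                 ∎)
  where
  open ≤-Reasoning
  g-step : g (suc m) ≤ g m
  g-step = descends m ≤-refl
  previous : g m ≤ g 0 × c 0 ≤ c m + q * (g 0 ∸ g m)
  previous = telescoping-bound c g q m (λ k k<m → descends k (m<n⇒m<1+n k<m))
                                       (λ k k<m → steps k (m<n⇒m<1+n k<m))
  g-total : g m ≤ g 0
  g-total = proj₁ previous
  c-total : c 0 ≤ c m + q * (g 0 ∸ g m)
  c-total = proj₂ previous

Raises : ∀ {n} → SetFun n → Subset n → Fin n → Set
Raises f A e = f A < f (A ∪ ⁅ e ⁆)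

module Polymatroid {n} {f : SetFun n} (pf : IsPolymatroid f) where
  open IsPolymatroid pf

  raises-antitone : ∀ {A B e} → A ⊆ B → Raises f B e → Raises f A e
  raises-antitone {A} {B} {e} A⊆B B-raises = +-cancelˡ-≤ (f B) (suc (f A)) (f (A ∪ ⁅ e ⁆)) (begin
      f B + suc (f A)               ≡⟨ +-suc (f B) (f A) ⟩
      suc (f B) + f A               ≤⟨ +-monoˡ-≤ (f A) B-raises ⟩
      f (B ∪ ⁅ e ⁆) + f A           ≤⟨ +-mono-≤ (monotone B∪e⊆A∪e∪B) (monotone A⊆A∪e∩B) ⟩
      f ((A ∪ ⁅ e ⁆) ∪ B) + f ((A ∪ ⁅ e ⁆) ∩ B)
                                    ≤⟨ submodular (A ∪ ⁅ e ⁆) B ⟩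
      f (A ∪ ⁅ e ⁆) + f B           ≡⟨ +-comm (f (A ∪ ⁅ e ⁆)) (f B) ⟩
      f B + f (A ∪ ⁅ e ⁆)           ∎)
    where
    open ≤-Reasoning
    B∪e⊆A∪e∪B : B ∪ ⁅ e ⁆ ⊆ (A ∪ ⁅ e ⁆) ∪ B
    B∪e⊆A∪e∪B = p⊆q∧x∈q⇒p∪⁅x⁆⊆q (q⊆p∪q (A ∪ ⁅ e ⁆) B) (p⊆p∪q B (q⊆p∪q A ⁅ e ⁆ (x∈⁅x⁆ e)))
    A⊆A∪e∩B : A ⊆ (A ∪ ⁅ e ⁆) ∩ B
    A⊆A∪e∩B x∈A = x∈p∩q⁺ (p⊆p∪q ⁅ e ⁆ x∈A , A⊆B x∈A)

  nonempty-positive : (∀ e → 0 < f ⁅ e ⁆) → ∀ {A} → Nonempty A → 0 < f A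
  nonempty-positive pos {A} (x , x∈A) =
    <-≤-trans (pos x) (monotone λ y∈⁅x⁆ → subst (_∈ A) (sym (x∈⁅y⁆⇒x≡y x y∈⁅x⁆)) x∈A)

module StrengthDecomposition {n} {f : SetFun n} (pf : IsPolymatroid f) (pos : ∀ e → 0 < f ⁅ e ⁆)
  {M : Subset n} {w : ℕ} {S : ℕ → Subset n} (sd : IsStrengthDecomposition f M w S) where
  open IsPolymatroid pf
  open Polymatroid pf
  open IsStrengthDecomposition sd

  S-antitone′ : ∀ {k l} → k ≤′ l → l ≤ w → S l ⊆ S k
  S-antitone′ ≤′-refl _ = ⊆-refl
  S-antitone′ (≤′-step k≤′l) l<w = ⊆-trans (sub _ l<w) (S-antitone′ k≤′l (<⇒≤ l<w))

  S-antitone : ∀ {k l} → k ≤ l → l ≤ w → S l ⊆ S k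
  S-antitone k≤l = S-antitone′ (≤⇒≤′ k≤l)

  S⊆M : ∀ {k} → k ≤ w → S k ⊆ M
  S⊆M k≤w = subst (_ ⊆_) start (S-antitone z≤n k≤w)

  -- Competing with ∅: a step on which f does not drop would have φ = +∞.
  f∘S-drops : ∀ {k} → k < w → f (S (suc k)) < f (S k)
  f∘S-drops {k} k<w = ∸-cancelʳ-< (subst (_< f (S k) ∸ f (S (suc k))) (sym (n∸n≡0 (f (S k)))) gap>0)
    where
    Sk-nonempty : Nonempty (S k)
    Sk-nonempty with nonempty? (S k)
    ... | yes ne = ne
    ... | no empty = contradiction (Empty-unique empty) (nonempty k k<w)
    f∘S-positive : 0 < f (S k) ∸ f ⊥
    f∘S-positive = subst (λ z → 0 < f (S k) ∸ z) (sym empty0) (nonempty-positive pos Sk-nonempty)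
    gap>0 : 0 < f (S k) ∸ f (S (suc k))
    gap>0 = a/b≤ᵉc/d⇒0<b f∘S-positive (minimizes k k<w ⊥ ⊥⊆)

  step-bound : ∀ {k T} → k < w → T ⊆ S k → f T < f (S k)
    → ∣ S k ∣ ≤ ∣ S (suc k) ∣ + (∣ S k ∣ ∸ ∣ T ∣) * (f (S k) ∸ f (S (suc k)))
  step-bound {k} {T} k<w T⊆Sk fT<fSk = ≤-trans (m≤n+m∸n ∣ S k ∣ ∣ S (suc k) ∣)
    (+-monoʳ-≤ ∣ S (suc k) ∣ (a/b≤ᵉc/d⇒a≤c*b (m<n⇒0<n∸m fT<fSk) (minimizes k k<w T T⊆Sk)))

  step-bound-by-quotient : ∀ {Q t k} → IsQuotient f M Q → t ∈ Q → k < w → t ∈ S k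
    → ∣ S k ∣ ≤ ∣ S (suc k) ∣ + ∣ Q ∣ * (f (S k) ∸ f (S (suc k)))
  step-bound-by-quotient {Q} {t} {k} (_ , Q-raises) t∈Q k<w t∈Sk =
    ≤-trans (step-bound k<w (p─q⊆p (S k) Q) fT<fSk) (+-monoʳ-≤ ∣ S (suc k) ∣ (*-monoˡ-≤ _ lost≤∣Q∣))
    where
    T : Subset n
    T = S k ─ Q
    T⊆M─Q : T ⊆ M ─ Q
    T⊆M─Q x∈T = x∈p∧x∉q⇒x∈p─q (S⊆M (<⇒≤ k<w) (p─q⊆p (S k) Q x∈T)) (x∈p─q⇒x∉q (S k) Q x∈T)
    fT<fSk : f T < f (S k)
    fT<fSk = <-≤-trans (raises-antitone T⊆M─Q (Q-raises t t∈Q))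
                       (monotone (p⊆q∧x∈q⇒p∪⁅x⁆⊆q (p─q⊆p (S k) Q) t∈Sk))
    lost≤∣Q∣ : ∣ S k ∣ ∸ ∣ T ∣ ≤ ∣ Q ∣
    lost≤∣Q∣ = m≤n+o⇒m∸n≤o ∣ S k ∣ ∣ T ∣ (∣p∣≤∣p─q∣+∣q∣ (S k) Q)

  -- If adding e to S (k+1) did not raise f, S (k+1) ∪ ⁅ e ⁆ would have the same
  -- denominator in φ (· | S k) and a smaller numerator.
  raises-on-step : ∀ {k e} → k < w → e ∈ S k → e ∉ S (suc k) → Raises f (S (suc k)) e
  raises-on-step {k} {e} k<w e∈Sk e∉S′ with f (S (suc k)) <? f (S (suc k) ∪ ⁅ e ⁆)
  ... | yes raises = raises
  ... | no ¬raises = contradiction (a/b≤ᵉc/b⇒a≤c (m<n⇒0<n∸m (f∘S-drops k<w)) same-den) (<⇒≱ fewer-lost)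
    where
    S′ T : Subset n
    S′ = S (suc k)
    T = S′ ∪ ⁅ e ⁆
    T⊆Sk : T ⊆ S k
    T⊆Sk = p⊆q∧x∈q⇒p∪⁅x⁆⊆q (sub k k<w) e∈Sk
    fT≡fS′ : f T ≡ f S′
    fT≡fS′ = ≤-antisym (≮⇒≥ ¬raises) (monotone (p⊆p∪q ⁅ e ⁆))
    same-den : ((∣ S k ∣ ∸ ∣ S′ ∣) / (f (S k) ∸ f S′)) ≤ᵉ ((∣ S k ∣ ∸ ∣ T ∣) / (f (S k) ∸ f S′))
    same-den = subst (λ z → φ f S′ (S k) ≤ᵉ ((∣ S k ∣ ∸ ∣ T ∣) / (f (S k) ∸ z))) fT≡fS′
                     (minimizes k k<w T T⊆Sk)
    fewer-lost : ∣ S k ∣ ∸ ∣ T ∣ < ∣ S k ∣ ∸ ∣ S′ ∣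
    fewer-lost = ∸-monoʳ-< (p⊂q⇒∣p∣<∣q∣ (p⊆p∪q ⁅ e ⁆ , e , q⊆p∪q S′ ⁅ e ⁆ (x∈⁅x⁆ e) , e∉S′))
                           (p⊆q⇒∣p∣≤∣q∣ T⊆Sk)

  raises-outside : ∀ {k e} → k ≤ w → e ∈ M ─ S k → Raises f (S k) e
  raises-outside {zero} {e} _ e∈M─S0 =
    contradiction (subst (e ∈_) (sym start) (p─q⊆p M (S 0) e∈M─S0)) (x∈p─q⇒x∉q M (S 0) e∈M─S0)
  raises-outside {suc k} {e} k<w e∈M─S′ with e ∈? S k
  ... | yes e∈Sk = raises-on-step k<w e∈Sk (x∈p─q⇒x∉q M (S (suc k)) e∈M─S′)
  ... | no e∉Sk = raises-antitone (sub k k<w)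
      (raises-outside (<⇒≤ k<w) (x∈p∧x∉q⇒x∈p─q (p─q⊆p M (S (suc k)) e∈M─S′) e∉Sk))

  complement-isQuotient : ∀ {k} → k ≤ w → IsQuotient f M (M ─ S k)
  complement-isQuotient {k} k≤w = p─q⊆p M (S k) , λ e e∈M─Sk →
    subst (λ X → Raises f X e) (sym (p─[p─q]≡q (S⊆M k≤w))) (raises-outside k≤w e∈M─Sk)

  telescoped-bound : ∀ {Q t i} → IsQuotient f M Q → t ∈ Q → i ≤ w → (∀ k → k < i → t ∈ S k)
    → ∣ M ∣ ≤ ∣ S i ∣ + ∣ Q ∣ * (f M ∸ f (S i))
  telescoped-bound {Q} {t} {i} Q-quot t∈Q i≤w t∈S =
    subst (λ X → ∣ X ∣ ≤ ∣ S i ∣ + ∣ Q ∣ * (f X ∸ f (S i))) start (proj₂ (telescoping-bound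
      (λ k → ∣ S k ∣) (λ k → f (S k)) ∣ Q ∣ i
      (λ k k<i → <⇒≤ (f∘S-drops (<-≤-trans k<i i≤w)))
      (λ k k<i → step-bound-by-quotient Q-quot t∈Q (<-≤-trans k<i i≤w) (t∈S k k<i))))

  complement-bound : ∀ {Q t i} → IsQuotient f M Q → t ∈ Q → i ≤ w → (∀ k → k < i → t ∈ S k)
    → ∣ M ─ S i ∣ ≤ ∣ Q ∣ * (f M ∸ f (S i))
  complement-bound {Q} {t} {i} Q-quot t∈Q i≤w t∈S = begin
    ∣ M ─ S i ∣                     ≡⟨ m+n∸n≡m ∣ M ─ S i ∣ ∣ S i ∣ ⟨
    ∣ M ─ S i ∣ + ∣ S i ∣ ∸ ∣ S i ∣ ≡⟨ cong (_∸ ∣ S i ∣) (∣p─q∣+∣q∣≡∣p∣ (S⊆M i≤w)) ⟩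
    ∣ M ∣ ∸ ∣ S i ∣                 ≤⟨ m≤n+o⇒m∸n≤o ∣ M ∣ ∣ S i ∣ (telescoped-bound Q-quot t∈Q i≤w t∈S) ⟩
    ∣ Q ∣ * (f M ∸ f (S i))         ∎
    where open ≤-Reasoning

lemma4p5 : (n : ℕ) (f : SetFun n) → IsPolymatroid f
    → (∀ e → 0 < f ⁅ e ⁆)
    → (t : Fin n)
    → (w : ℕ) (S : ℕ → Subset n) → IsStrengthDecomposition f (prefix t) w S
    → (i : ℕ) → 1 ≤ i → i ≤ w → t ∈ S (i ∸ 1) → t ∉ S i
    → (q : ℕ) → IsMinQuotientSize f (prefix t) t q
    → ((q / f ⊤) ≤ᵉ ((∣ prefix t ─ S i ∣) / (f (prefix t) ∸ f (S i))))
    × (((∣ prefix t ─ S i ∣) / (f (prefix t) ∸ f (S i))) ≤ᵉ (q / 1))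
lemma4p5 n f pf pos t w S sd (suc i′) _ i≤w t∈Si′ t∉Si q ((Q , Q-quot , t∈Q , ∣Q∣≡q) , q-minimal) =
    a*d≤c*b⇒a/b≤ᵉc/d (nonempty-positive pos (t , ∈⊤)) gap>0
      (*-mono-≤ (q-minimal (M ─ S i) (complement-isQuotient i≤w) t∈M─Si) (≤-trans (m∸n≤m (f M) (f (S i))) (monotone ⊆⊤)))
  , a*d≤c*b⇒a/b≤ᵉc/d gap>0 (s≤s z≤n)
      (subst₂ _≤_ (sym (*-identityʳ _)) (cong (_* _) ∣Q∣≡q)
        (complement-bound Q-quot t∈Q i≤w λ k k<i → S-antitone (≤-pred k<i) (<⇒≤ i≤w) t∈Si′))
  where
  open IsPolymatroid pf
  open Polymatroid pf
  open StrengthDecomposition pf pos sd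
  M : Subset n
  M = prefix t
  i : ℕ
  i = suc i′
  gap>0 : 0 < f M ∸ f (S i)
  gap>0 = m<n⇒0<n∸m (<-≤-trans (f∘S-drops i≤w) (monotone (S⊆M (<⇒≤ i≤w))))
  t∈M─Si : t ∈ M ─ S i
  t∈M─Si = x∈p∧x∉q⇒x∈p─q (S⊆M (<⇒≤ i≤w) t∈Si′) t∉Si
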